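{- Let $q,n,d \in \mathbb{N}$ satisfy $qd = (q-1)n$. Then every $(n,d)_q$-code $C \subseteq [q]^n$ with $|C| = qn - 1$ can be extended to an $(n,d)_q$-code of size $qn$, i.e., there exists $u \in [q]^n \setminus C$ such that $C \cup \{u\}$ is an $(n,d)_q$-code.
   Context: For $m \in \mathbb{N}$, $[m] = \{1,\ldots,m\}$. An $(n,d)_q$-code is a set $C \subseteq [q]^n$ in which any two distinct words have Hamming distance at least $d$. -}

module Defs where

open import Data.Nat using (ℕ; zero; suc; _≤_)
open import Data.Fin using (Fin)
open import Data.Fin.Properties using (_≟_)
open import Data.Vec using (Vec; []; _∷_)
open import Data.Bool using (if_then_else_)
open import Data.List using (List)
open import Data.List.Membership.Propositional using (_∈_)
open import Relation.Nullary using (does; ¬_)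
open import Relation.Binary.PropositionalEquality using (_≡_)

Word : ℕ → ℕ → Set
Word q n = Vec (Fin q) n

hamming : ∀ {q n} → Word q n → Word q n → ℕ
hamming [] [] = 0
hamming (x ∷ xs) (y ∷ ys) =
  if does (x ≟ y) then hamming xs ys else suc (hamming xs ys)

-- A finite set C ⊆ [q]^n (given as a list, duplicate-freeness imposed
-- separately) is an (n,d)_q-code if any two distinct words of C have
-- Hamming distance at least d.
IsCode : ∀ {q n} → ℕ → List (Word q n) → Set
IsCode d C = ∀ {x y} → x ∈ C → y ∈ C → ¬ (x ≡ y) → d ≤ hamming x y

-- With k = n ∸ d we have q·k = n, and a code of minimum distance d is a list of words any two of
-- which agree in at most k coordinates. Double counting agreements inside a subcode S whose words
-- share a symbol in coordinate i, with Cauchy–Schwarz on every column, gives |S| ≤ n, and if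
-- |S| = n then every other column of S contains each symbol exactly k times.
-- Since |C| = qn − 1, in each coordinate i exactly one symbol uᵢ occurs only n − 1 times, and the
-- other subcodes C_{i,a} are full, hence balanced; therefore u ∷ C_{i,uᵢ} also has k copies of
-- each symbol in every column j ≠ i. Counting agreements against this column profile shows that
-- each y ∈ C_{i,uᵢ} agrees with u in at least k coordinates while the total over C_{i,uᵢ} is
-- exactly k·|C_{i,uᵢ}|, so each agrees in exactly k. Words of C outside every C_{i,uᵢ} do not agree
-- with u anywhere, and u ∉ C because u agrees with itself in n > k coordinates.

module Submission where

open import Defs
open import Data.Nat using (ℕ; zero; suc; _+_; _*_; _∸_; _≤_; _<_; z≤n; s≤s; _≤?_; ∣_-_∣; NonZero)
open import Data.Nat.Properties hiding (_≟_)
open import Data.Nat.Tactic.RingSolver using (solve-∀)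
open import Data.Fin using (Fin; zero; suc)
open import Data.Fin.Properties using (_≟_; ¬∀⟶∃¬; any?)
open import Data.Vec using ([]; _∷_; lookup; tabulate)
open import Data.Vec.Properties using (lookup∘tabulate)
open import Data.Bool using (if_then_else_; true; false)
open import Data.List as List using (List; []; _∷_; length; filter)
open import Data.List.Membership.Propositional using (_∈_; _∉_)
open import Data.List.Membership.Propositional.Properties using (∈-lookup; ∈-filter⁺; ∈-filter⁻)
open import Data.List.Relation.Unary.Any using (here; there; index)
open import Data.List.Relation.Unary.Any.Properties using (lookup-index)
import Data.List.Relation.Unary.All as All
open import Data.List.Relation.Unary.AllPairs using (_∷_)
open import Data.List.Relation.Unary.Unique.Propositional using (Unique)
open import Data.List.Relation.Unary.Unique.Propositional.Properties using (filter⁺)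
open import Data.Product using (_×_; _,_; proj₁; proj₂; map₂; ∃-syntax)
open import Data.Sum using (inj₁; inj₂)
open import Function using (_∘_)
open import Relation.Nullary using (does; ¬_; yes; no; contradiction)
open import Relation.Binary.PropositionalEquality
open import Algebra.Properties.CommutativeMonoid.Sum +-0-commutativeMonoid
  using (sum; sum-syntax; ∑-distrib-+; ∑-comm; sum-cong-≗; sum-replicate-zero)
open import Algebra.Properties.Semiring.Sum +-*-semiring using (*-distribˡ-sum; *-distribʳ-sum)

∑-const : ∀ n c → ∑[ i < n ] c ≡ n * c
∑-const zero    c = refl
∑-const (suc n) c = cong (c +_) (∑-const n c)

∑-mono-≤ : ∀ {n} {f g : Fin n → ℕ} → (∀ i → f i ≤ g i) → sum f ≤ sum g
∑-mono-≤ {zero}  f≤g = z≤n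
∑-mono-≤ {suc n} f≤g = +-mono-≤ (f≤g zero) (∑-mono-≤ (f≤g ∘ suc))

∑-mono-≤-tight : ∀ {n} {f g : Fin n → ℕ} → (∀ i → f i ≤ g i) → sum g ≤ sum f → ∀ i → f i ≡ g i
∑-mono-≤-tight {suc n} {f} {g} f≤g ∑g≤∑f zero = ≤-antisym (f≤g zero)
  (+-cancelʳ-≤ _ _ _ (≤-trans ∑g≤∑f (+-monoʳ-≤ (f zero) (∑-mono-≤ (f≤g ∘ suc)))))
∑-mono-≤-tight {suc n} {f} {g} f≤g ∑g≤∑f (suc i) = ∑-mono-≤-tight (f≤g ∘ suc)
  (+-cancelˡ-≤ (g zero) _ _ (≤-trans ∑g≤∑f (+-monoˡ-≤ _ (f≤g zero)))) i

δ : ∀ {q} → Fin q → Fin q → ℕ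
δ a b = if does (a ≟ b) then 1 else 0

δ-refl : ∀ {q} (a : Fin q) → δ a a ≡ 1
δ-refl a with a ≟ a
... | yes _  = refl
... | no a≢a = contradiction refl a≢a

δ-≢ : ∀ {q} {a b : Fin q} → a ≢ b → δ a b ≡ 0
δ-≢ {a = a} {b} a≢b with a ≟ b
... | yes a≡b = contradiction a≡b a≢b
... | no _    = refl

δ-sym : ∀ {q} (a b : Fin q) → δ a b ≡ δ b a
δ-sym a b with a ≟ b | b ≟ a
... | yes _   | yes _   = refl
... | no _    | no _    = refl
... | yes a≡b | no b≢a  = contradiction (sym a≡b) b≢a
... | no a≢b  | yes b≡a = contradiction (sym b≡a) a≢b

∑-δ : ∀ {q} (c : Fin q) (g : Fin q → ℕ) → ∑[ b < q ] (δ c b * g b) ≡ g c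
∑-δ {suc q} zero    g =
  trans (cong₂ _+_ (+-identityʳ (g zero)) (sum-replicate-zero q)) (+-identityʳ (g zero))
∑-δ {suc q} (suc c) g = ∑-δ c (g ∘ suc)

∑-δ≡1 : ∀ {q} (c : Fin q) → ∑[ b < q ] δ c b ≡ 1
∑-δ≡1 c = trans (sum-cong-≗ (λ b → sym (*-identityʳ (δ c b)))) (∑-δ c (λ _ → 1))

∑-except : ∀ {q} {f : Fin q → ℕ} {k} (c : Fin q) → (∀ a → c ≢ a → f a ≡ k) →
           sum f + k ≡ f c + q * k
∑-except {q} {f} {k} c f≡k = begin
  sum f + k                            ≡⟨ cong (sum f +_) (∑-δ c (λ _ → k)) ⟨
  sum f + ∑[ a < q ] (δ c a * k)       ≡⟨ ∑-distrib-+ f (λ a → δ c a * k) ⟨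
  ∑[ a < q ] (f a + δ c a * k)         ≡⟨ sum-cong-≗ pointwise ⟩
  ∑[ a < q ] (k + δ c a * f c)         ≡⟨ ∑-distrib-+ (λ _ → k) (λ a → δ c a * f c) ⟩
  ∑[ a < q ] k + ∑[ a < q ] (δ c a * f c) ≡⟨ cong₂ _+_ (∑-const q k) (∑-δ c (λ _ → f c)) ⟩
  q * k + f c                          ≡⟨ +-comm (q * k) (f c) ⟩
  f c + q * k                          ∎
  where
  open ≡-Reasoning
  pointwise : ∀ a → f a + δ c a * k ≡ k + δ c a * f c
  pointwise a with c ≟ a
  ... | yes refl = trans (+-comm (f c) (1 * k)) (cong₂ _+_ (*-identityˡ k) (sym (*-identityˡ (f c))))
  ... | no c≢a   = cong (_+ 0) (f≡k a c≢a)

m≤n⇒m*m+n*n≡2*m*n+∣m-n∣*∣m-n∣ : ∀ {m n} → m ≤ n →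
                                  m * m + n * n ≡ 2 * m * n + ∣ m - n ∣ * ∣ m - n ∣
m≤n⇒m*m+n*n≡2*m*n+∣m-n∣*∣m-n∣ {m} m≤n with m≤n⇒∃[o]m+o≡n m≤n
... | o , refl rewrite ∣m-m+n∣≡n m o = identity m o
  where
  identity : ∀ m o → m * m + (m + o) * (m + o) ≡ 2 * m * (m + o) + o * o
  identity = solve-∀

m*m+n*n≡2*m*n+∣m-n∣*∣m-n∣ : ∀ m n → m * m + n * n ≡ 2 * m * n + ∣ m - n ∣ * ∣ m - n ∣
m*m+n*n≡2*m*n+∣m-n∣*∣m-n∣ m n with ≤-total m n
... | inj₁ m≤n = m≤n⇒m*m+n*n≡2*m*n+∣m-n∣*∣m-n∣ m≤n
... | inj₂ n≤m = begin
  m * m + n * n                           ≡⟨ +-comm (m * m) (n * n) ⟩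
  n * n + m * m                           ≡⟨ m≤n⇒m*m+n*n≡2*m*n+∣m-n∣*∣m-n∣ n≤m ⟩
  2 * n * m + ∣ n - m ∣ * ∣ n - m ∣
    ≡⟨ cong₂ _+_ (2nm≡2mn n m) (cong₂ _*_ (∣-∣-comm n m) (∣-∣-comm n m)) ⟩
  2 * m * n + ∣ m - n ∣ * ∣ m - n ∣       ∎
  where
  open ≡-Reasoning
  2nm≡2mn : ∀ n m → 2 * n * m ≡ 2 * m * n
  2nm≡2mn = solve-∀

2*m*n≤m*m+n*n : ∀ m n → 2 * m * n ≤ m * m + n * n
2*m*n≤m*m+n*n m n = ≤-trans (m≤m+n _ _) (≤-reflexive (sym (m*m+n*n≡2*m*n+∣m-n∣*∣m-n∣ m n)))

m*m+n*n≡2*m*n⇒m≡n : ∀ {m n} → m * m + n * n ≡ 2 * m * n → m ≡ n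
m*m+n*n≡2*m*n⇒m≡n {m} {n} eq = ∣m-n∣≡0⇒m≡n (square≡0⇒≡0 (+-cancelˡ-≡ (2 * m * n) _ 0 (begin
  2 * m * n + ∣ m - n ∣ * ∣ m - n ∣ ≡⟨ m*m+n*n≡2*m*n+∣m-n∣*∣m-n∣ m n ⟨
  m * m + n * n                     ≡⟨ eq ⟩
  2 * m * n                         ≡⟨ +-identityʳ _ ⟨
  2 * m * n + 0                     ∎)))
  where
  open ≡-Reasoning
  square≡0⇒≡0 : ∀ {x} → x * x ≡ 0 → x ≡ 0
  square≡0⇒≡0 {x} xx≡0 with m*n≡0⇒m≡0∨n≡0 x xx≡0
  ... | inj₁ x≡0 = x≡0
  ... | inj₂ x≡0 = x≡0

-- Cauchy–Schwarz is the sum over b of AM–GM: 2·(q·m b)·Σm ≤ (q·m b)² + (Σm)².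
private
  ∑-amgm-left : ∀ {q} (m : Fin q → ℕ) →
                ∑[ b < q ] (2 * (q * m b) * sum m) ≡ q * (sum m * sum m) + q * (sum m * sum m)
  ∑-amgm-left {q} m = begin
    ∑[ b < q ] (2 * (q * m b) * sum m) ≡⟨ sum-cong-≗ (λ b → rearrange q (m b) (sum m)) ⟩
    ∑[ b < q ] ((2 * q * sum m) * m b) ≡⟨ *-distribˡ-sum (2 * q * sum m) m ⟨
    2 * q * sum m * sum m              ≡⟨ double q (sum m) ⟩
    q * (sum m * sum m) + q * (sum m * sum m) ∎
    where
    open ≡-Reasoning
    rearrange : ∀ q x M → 2 * (q * x) * M ≡ (2 * q * M) * x
    rearrange = solve-∀
    double : ∀ q M → 2 * q * M * M ≡ q * (M * M) + q * (M * M)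
    double = solve-∀

  ∑-amgm-right : ∀ {q} (m : Fin q → ℕ) → ∑[ b < q ] (q * m b * (q * m b) + sum m * sum m) ≡
                 q * (q * ∑[ b < q ] (m b * m b)) + q * (sum m * sum m)
  ∑-amgm-right {q} m = begin
    ∑[ b < q ] (q * m b * (q * m b) + sum m * sum m)
      ≡⟨ ∑-distrib-+ (λ b → q * m b * (q * m b)) (λ _ → sum m * sum m) ⟩
    ∑[ b < q ] (q * m b * (q * m b)) + ∑[ b < q ] (sum m * sum m)
      ≡⟨ cong₂ _+_ (sum-cong-≗ (λ b → rearrange q (m b))) (∑-const q (sum m * sum m)) ⟩
    ∑[ b < q ] (q * (q * (m b * m b))) + q * (sum m * sum m)
      ≡⟨ cong (_+ q * (sum m * sum m)) distrib ⟨
    q * (q * ∑[ b < q ] (m b * m b)) + q * (sum m * sum m) ∎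
    where
    open ≡-Reasoning
    rearrange : ∀ q x → q * x * (q * x) ≡ q * (q * (x * x))
    rearrange = solve-∀
    distrib : q * (q * ∑[ b < q ] (m b * m b)) ≡ ∑[ b < q ] (q * (q * (m b * m b)))
    distrib = trans (cong (q *_) (*-distribˡ-sum q (λ b → m b * m b))) (*-distribˡ-sum q (λ b → q * (m b * m b)))

cauchy-schwarz : ∀ {q} (m : Fin q → ℕ) → sum m * sum m ≤ q * ∑[ b < q ] (m b * m b)
cauchy-schwarz {zero}  m = z≤n
cauchy-schwarz {suc q} m = *-cancelˡ-≤ (suc q) (+-cancelʳ-≤ _ _ _ (begin
  suc q * (sum m * sum m) + suc q * (sum m * sum m)     ≡⟨ ∑-amgm-left m ⟨
  ∑[ b < suc q ] (2 * (suc q * m b) * sum m)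
    ≤⟨ ∑-mono-≤ (λ b → 2*m*n≤m*m+n*n (suc q * m b) (sum m)) ⟩
  ∑[ b < suc q ] (suc q * m b * (suc q * m b) + sum m * sum m) ≡⟨ ∑-amgm-right m ⟩
  suc q * (suc q * ∑[ b < suc q ] (m b * m b)) + suc q * (sum m * sum m) ∎))
  where open ≤-Reasoning

cauchy-schwarz-tight : ∀ {q} (m : Fin q → ℕ) → q * ∑[ b < q ] (m b * m b) ≤ sum m * sum m →
                       ∀ b → q * m b ≡ sum m
cauchy-schwarz-tight {q} m q∑m²≤[∑m]² b = m*m+n*n≡2*m*n⇒m≡n (sym (∑-mono-≤-tight
  (λ b → 2*m*n≤m*m+n*n (q * m b) (sum m))
  (begin
    ∑[ b < q ] (q * m b * (q * m b) + sum m * sum m)        ≡⟨ ∑-amgm-right m ⟩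
    q * (q * ∑[ b < q ] (m b * m b)) + q * (sum m * sum m)  ≤⟨ +-monoˡ-≤ _ (*-monoʳ-≤ q q∑m²≤[∑m]²) ⟩
    q * (sum m * sum m) + q * (sum m * sum m)               ≡⟨ ∑-amgm-left m ⟨
    ∑[ b < q ] (2 * (q * m b) * sum m)                      ∎) b))
  where open ≤-Reasoning

-- Sums over a list are indexed by positions, so that the library's Fin-indexed sums apply.
∑∈ : ∀ {A : Set} → List A → (A → ℕ) → ℕ
∑∈ S f = ∑[ i < length S ] f (List.lookup S i)

infixl 10 ∑∈
syntax ∑∈ S (λ x → e) = ∑[ x ∈ S ] e

module _ {A : Set} {S : List A} {f g : A → ℕ} where

  ∑∈-mono-≤ : (∀ {x} → x ∈ S → f x ≤ g x) → ∑∈ S f ≤ ∑∈ S g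
  ∑∈-mono-≤ f≤g = ∑-mono-≤ (λ i → f≤g (∈-lookup i))

  ∑∈-mono-≤-tight : (∀ {x} → x ∈ S → f x ≤ g x) → ∑∈ S g ≤ ∑∈ S f → ∀ {x} → x ∈ S → f x ≡ g x
  ∑∈-mono-≤-tight f≤g ∑g≤∑f x∈S rewrite lookup-index x∈S =
    ∑-mono-≤-tight (λ i → f≤g (∈-lookup i)) ∑g≤∑f (index x∈S)

∑∈-const : ∀ {A : Set} (S : List A) c → ∑[ x ∈ S ] c ≡ length S * c
∑∈-const S c = ∑-const (length S) c

∑∈-1≡length : ∀ {A : Set} (S : List A) → ∑[ x ∈ S ] 1 ≡ length S
∑∈-1≡length S = trans (∑∈-const S 1) (*-identityʳ (length S))

module _ {A : Set} {q} (key : A → Fin q) where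

  ∑∈-filter : ∀ a (S : List A) (f : A → ℕ) →
              ∑[ x ∈ filter (λ x → key x ≟ a) S ] f x ≡ ∑[ x ∈ S ] (δ (key x) a * f x)
  ∑∈-filter a []      f = refl
  ∑∈-filter a (x ∷ S) f with does (key x ≟ a)
  ... | true  = cong₂ _+_ (sym (+-identityʳ (f x))) (∑∈-filter a S f)
  ... | false = ∑∈-filter a S f

  ∑-∑∈-filter : ∀ (S : List A) (f : A → ℕ) →
                ∑[ a < q ] ∑[ x ∈ filter (λ x → key x ≟ a) S ] f x ≡ ∑[ x ∈ S ] f x
  ∑-∑∈-filter S f = begin
    ∑[ a < q ] ∑[ x ∈ filter (λ x → key x ≟ a) S ] f x ≡⟨ sum-cong-≗ (λ a → ∑∈-filter a S f) ⟩
    ∑[ a < q ] ∑[ x ∈ S ] (δ (key x) a * f x)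
      ≡⟨ ∑-comm (λ a i → δ (key (List.lookup S i)) a * f (List.lookup S i)) ⟩
    ∑[ x ∈ S ] ∑[ a < q ] (δ (key x) a * f x)
      ≡⟨ sum-cong-≗ (λ i → ∑-δ (key (List.lookup S i)) (λ _ → f (List.lookup S i))) ⟩
    ∑[ x ∈ S ] f x                                     ∎
    where open ≡-Reasoning

agreement : ∀ {q n} → Word q n → Word q n → ℕ
agreement {n = n} x y = ∑[ j < n ] δ (lookup x j) (lookup y j)

hamming+agreement≡n : ∀ {q n} (x y : Word q n) → hamming x y + agreement x y ≡ n
hamming+agreement≡n []       []       = refl
hamming+agreement≡n (a ∷ xs) (b ∷ ys) with does (a ≟ b)
... | true  = trans (+-suc _ _) (cong suc (hamming+agreement≡n xs ys))
... | false = cong suc (hamming+agreement≡n xs ys)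

agreement-sym : ∀ {q n} (x y : Word q n) → agreement x y ≡ agreement y x
agreement-sym x y = sum-cong-≗ (λ j → δ-sym (lookup x j) (lookup y j))

agreement-self : ∀ {q n} (x : Word q n) → agreement x x ≡ n
agreement-self {n = n} x = begin
  agreement x x ≡⟨ sum-cong-≗ (λ j → δ-refl (lookup x j)) ⟩
  ∑[ j < n ] 1  ≡⟨ ∑-const n 1 ⟩
  n * 1         ≡⟨ *-identityʳ n ⟩
  n             ∎
  where open ≡-Reasoning

count : ∀ {q n} → List (Word q n) → Fin n → Fin q → ℕ
count S j b = ∑[ y ∈ S ] δ (lookup y j) b

module _ {q n} (S : List (Word q n)) where

  ∑∈-column : ∀ j (g : Fin q → ℕ) → ∑[ y ∈ S ] g (lookup y j) ≡ ∑[ b < q ] (count S j b * g b)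
  ∑∈-column j g = begin
    ∑[ y ∈ S ] g (lookup y j)                  ≡⟨ sum-cong-≗ (λ i → ∑-δ (lookup (List.lookup S i) j) g) ⟨
    ∑[ y ∈ S ] (∑[ b < q ] (δ (lookup y j) b * g b))
      ≡⟨ ∑-comm (λ i b → δ (lookup (List.lookup S i) j) b * g b) ⟩
    ∑[ b < q ] ∑[ y ∈ S ] (δ (lookup y j) b * g b)
      ≡⟨ sum-cong-≗ (λ b → *-distribʳ-sum (g b) (λ i → δ (lookup (List.lookup S i) j) b)) ⟨
    ∑[ b < q ] (count S j b * g b)             ∎
    where open ≡-Reasoning

  count-total : ∀ j → ∑[ b < q ] count S j b ≡ length S
  count-total j = begin
    ∑[ b < q ] count S j b       ≡⟨ sum-cong-≗ (λ b → *-identityʳ (count S j b)) ⟨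
    ∑[ b < q ] (count S j b * 1) ≡⟨ ∑∈-column j (λ _ → 1) ⟨
    ∑[ y ∈ S ] 1                 ≡⟨ ∑∈-1≡length S ⟩
    length S                     ∎
    where open ≡-Reasoning

  ∑∈-agreement : ∀ x → ∑[ y ∈ S ] agreement y x ≡ ∑[ j < n ] count S j (lookup x j)
  ∑∈-agreement x = ∑-comm (λ i j → δ (lookup (List.lookup S i) j) (lookup x j))

  ∑∈-∑∈-agreement : ∑[ x ∈ S ] (∑[ y ∈ S ] agreement y x) ≡ ∑[ j < n ] ∑[ b < q ] (count S j b * count S j b)
  ∑∈-∑∈-agreement = begin
    ∑[ x ∈ S ] (∑[ y ∈ S ] agreement y x)                 ≡⟨ sum-cong-≗ (∑∈-agreement ∘ List.lookup S) ⟩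
    ∑[ x ∈ S ] (∑[ j < n ] count S j (lookup x j))
      ≡⟨ ∑-comm (λ i j → count S j (lookup (List.lookup S i) j)) ⟩
    ∑[ j < n ] ∑[ x ∈ S ] count S j (lookup x j)          ≡⟨ sum-cong-≗ (λ j → ∑∈-column j (count S j)) ⟩
    ∑[ j < n ] ∑[ b < q ] (count S j b * count S j b)     ∎
    where open ≡-Reasoning

  count-fixed : ∀ {i a} → (∀ {x} → x ∈ S → lookup x i ≡ a) → count S i a ≡ length S
  count-fixed {i} {a} S-fixed =
    trans (sum-cong-≗ (λ l → trans (cong (λ c → δ c a) (S-fixed (∈-lookup l))) (δ-refl a))) (∑∈-1≡length S)

AgreementAtMost : ∀ {q n} → ℕ → List (Word q n) → Set
AgreementAtMost k S = ∀ {x y} → x ∈ S → y ∈ S → x ≢ y → agreement x y ≤ k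

module _ {q n d k : ℕ} (d+k≡n : d + k ≡ n) where

  agreement≤⇒hamming≥ : ∀ (x y : Word q n) → agreement x y ≤ k → d ≤ hamming x y
  agreement≤⇒hamming≥ x y agr≤k = +-cancelʳ-≤ k d (hamming x y) (begin
    d + k                           ≡⟨ d+k≡n ⟩
    n                               ≡⟨ hamming+agreement≡n x y ⟨
    hamming x y + agreement x y     ≤⟨ +-monoʳ-≤ (hamming x y) agr≤k ⟩
    hamming x y + k                 ∎)
    where open ≤-Reasoning

  IsCode⇒AgreementAtMost : ∀ {S : List (Word q n)} → IsCode d S → AgreementAtMost k S
  IsCode⇒AgreementAtMost code {x} {y} x∈S y∈S x≢y = +-cancelˡ-≤ d (agreement x y) k (begin
    d + agreement x y               ≤⟨ +-monoˡ-≤ (agreement x y) (code x∈S y∈S x≢y) ⟩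
    hamming x y + agreement x y     ≡⟨ hamming+agreement≡n x y ⟩
    n                               ≡⟨ d+k≡n ⟨
    d + k                           ∎)
    where open ≤-Reasoning

∑∈-agreement≤ : ∀ {q n k} {S : List (Word q n)} → Unique S → AgreementAtMost k S →
                ∀ {x} → x ∈ S → ∑[ y ∈ S ] agreement y x + k ≤ n + length S * k
∑∈-agreement≤ {n = n} {k} {x ∷ S} (x∉S ∷ _) S-agree (here refl) = begin
  agreement x x + ∑[ y ∈ S ] agreement y x + k
    ≡⟨ cong (λ a → a + ∑[ y ∈ S ] agreement y x + k) (agreement-self x) ⟩
  n + ∑[ y ∈ S ] agreement y x + k             ≡⟨ +-assoc n _ k ⟩
  n + (∑[ y ∈ S ] agreement y x + k)           ≤⟨ +-monoʳ-≤ n (≤-reflexive (+-comm _ k)) ⟩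
  n + (k + ∑[ y ∈ S ] agreement y x)           ≤⟨ +-monoʳ-≤ n (+-monoʳ-≤ k (∑∈-mono-≤ agreement≤k)) ⟩
  n + (k + ∑[ y ∈ S ] k)                       ≡⟨ cong (λ s → n + (k + s)) (∑∈-const S k) ⟩
  n + (k + length S * k)                       ∎
  where
  open ≤-Reasoning
  agreement≤k : ∀ {y} → y ∈ S → agreement y x ≤ k
  agreement≤k y∈S = S-agree (there y∈S) (here refl) (λ y≡x → All.lookup x∉S y∈S (sym y≡x))
∑∈-agreement≤ {n = n} {k} {z ∷ S} (z∉S ∷ S-unique) S-agree {x} (there x∈S) = begin
  agreement z x + ∑[ y ∈ S ] agreement y x + k   ≡⟨ +-assoc (agreement z x) _ k ⟩
  agreement z x + (∑[ y ∈ S ] agreement y x + k)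
    ≤⟨ +-mono-≤ agreement≤k (∑∈-agreement≤ S-unique (λ u∈S v∈S → S-agree (there u∈S) (there v∈S)) x∈S) ⟩
  k + (n + length S * k)                         ≡⟨ rearrange k n (length S * k) ⟩
  n + (k + length S * k)                         ∎
  where
  open ≤-Reasoning
  agreement≤k : agreement z x ≤ k
  agreement≤k = S-agree (here refl) (there x∈S) (λ z≡x → All.lookup z∉S x∈S z≡x)
  rearrange : ∀ a b c → a + (b + c) ≡ b + (a + c)
  rearrange = solve-∀

∑∈-∑∈-agreement≤ : ∀ {q n k} {S : List (Word q n)} → Unique S → AgreementAtMost k S →
                   ∑[ x ∈ S ] (∑[ y ∈ S ] agreement y x) + length S * k ≤ length S * (n + length S * k)
∑∈-∑∈-agreement≤ {n = n} {k} {S} S-unique S-agree = begin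
  ∑[ x ∈ S ] (∑[ y ∈ S ] agreement y x) + length S * k
    ≡⟨ cong (∑[ x ∈ S ] (∑[ y ∈ S ] agreement y x) +_) (∑∈-const S k) ⟨
  ∑[ x ∈ S ] (∑[ y ∈ S ] agreement y x) + ∑[ x ∈ S ] k
    ≡⟨ ∑-distrib-+ (λ i → ∑[ y ∈ S ] agreement y (List.lookup S i)) (λ _ → k) ⟨
  ∑[ x ∈ S ] (∑[ y ∈ S ] agreement y x + k)
    ≤⟨ ∑∈-mono-≤ (∑∈-agreement≤ S-unique S-agree) ⟩
  ∑[ x ∈ S ] (n + length S * k)
    ≡⟨ ∑∈-const S (n + length S * k) ⟩
  length S * (n + length S * k) ∎
  where open ≤-Reasoning

∑∈-agreement-balanced : ∀ {q n k} {T : List (Word q n)} (i : Fin n) {a : Fin q} → length T ≡ n →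
                        (∀ {x} → x ∈ T → lookup x i ≡ a) → (∀ j → i ≢ j → ∀ b → count T j b ≡ k) →
                        ∀ y → lookup y i ≡ a → ∑[ z ∈ T ] agreement z y + k ≡ n + n * k
∑∈-agreement-balanced {n = n} {k} {T} i {a} |T|≡n T-fixed T-balanced y yᵢ≡a = begin
  ∑[ z ∈ T ] agreement z y + k          ≡⟨ cong (_+ k) (∑∈-agreement T y) ⟩
  ∑[ j < n ] count T j (lookup y j) + k ≡⟨ ∑-except i (λ j i≢j → T-balanced j i≢j (lookup y j)) ⟩
  count T i (lookup y i) + n * k        ≡⟨ cong (λ c → count T i c + n * k) yᵢ≡a ⟩
  count T i a + n * k                   ≡⟨ cong (_+ n * k) (trans (count-fixed T T-fixed) |T|≡n) ⟩
  n + n * k                             ∎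
  where open ≡-Reasoning

module Plotkin {p n k : ℕ} .{{_ : NonZero p}} (qk≡n : suc p * k ≡ n)
  {S : List (Word (suc p) n)} (S-unique : Unique S) (S-agree : AgreementAtMost k S)
  (i : Fin n) {a : Fin (suc p)} (S-fixed : ∀ {x} → x ∈ S → lookup x i ≡ a) where

  private
    q M : ℕ
    q = suc p
    M = length S

    column² : Fin n → ℕ
    column² j = ∑[ b < q ] (count S j b * count S j b)

    column²-fixed : column² i ≡ M * M
    column²-fixed = begin
      column² i                              ≡⟨ ∑∈-column S i (count S i) ⟨
      ∑[ x ∈ S ] count S i (lookup x i)      ≡⟨ sum-cong-≗ (λ i′ → cong (count S i) (S-fixed (∈-lookup i′))) ⟩
      ∑[ x ∈ S ] count S i a                 ≡⟨ ∑∈-const S (count S i a) ⟩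
      M * count S i a                        ≡⟨ cong (M *_) (count-fixed S S-fixed) ⟩
      M * M                                  ∎
      where open ≡-Reasoning

    -- The constant column i contributes q·M², any other column at least M² (Cauchy–Schwarz).
    column²-lower : ∀ j → M * M + δ i j * (p * (M * M)) ≤ q * column² j
    column²-lower j with i ≟ j
    ... | yes refl = ≤-reflexive (begin
      M * M + 1 * (p * (M * M)) ≡⟨ rearrange p (M * M) ⟩
      q * (M * M)               ≡⟨ cong (q *_) column²-fixed ⟨
      q * column² i             ∎)
      where
      open ≡-Reasoning
      rearrange : ∀ p x → x + 1 * (p * x) ≡ suc p * x
      rearrange = solve-∀
    ... | no _ = begin
      M * M + 0                                              ≡⟨ +-identityʳ (M * M) ⟩
      M * M                                                  ≡⟨ cong (λ s → s * s) (count-total S j) ⟨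
      sum (count S j) * sum (count S j)                      ≤⟨ cauchy-schwarz (count S j) ⟩
      q * column² j                                          ∎
      where open ≤-Reasoning

    ∑-column²-lower : ∑[ j < n ] (M * M + δ i j * (p * (M * M))) ≡ n * (M * M) + p * (M * M)
    ∑-column²-lower = trans (∑-distrib-+ (λ _ → M * M) (λ j → δ i j * (p * (M * M))))
                            (cong₂ _+_ (∑-const n (M * M)) (∑-δ i (λ _ → p * (M * M))))

    lower : n * (M * M) + p * (M * M) ≤ q * ∑[ j < n ] column² j
    lower = begin
      n * (M * M) + p * (M * M)                      ≡⟨ ∑-column²-lower ⟨
      ∑[ j < n ] (M * M + δ i j * (p * (M * M)))     ≤⟨ ∑-mono-≤ column²-lower ⟩
      ∑[ j < n ] (q * column² j)                     ≡⟨ *-distribˡ-sum q column² ⟨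
      q * ∑[ j < n ] column² j                       ∎
      where open ≤-Reasoning

    upper : q * ∑[ j < n ] column² j + M * n ≤ q * (M * n) + M * (M * n)
    upper = begin
      q * ∑[ j < n ] column² j + M * n
        ≡⟨ cong₂ (λ s t → q * s + M * t) (∑∈-∑∈-agreement S) qk≡n ⟨
      q * ∑[ x ∈ S ] (∑[ y ∈ S ] agreement y x) + M * (q * k)
        ≡⟨ cong (q * ∑[ x ∈ S ] (∑[ y ∈ S ] agreement y x) +_) (rearrangeˡ q M k) ⟩
      q * ∑[ x ∈ S ] (∑[ y ∈ S ] agreement y x) + q * (M * k)
        ≡⟨ *-distribˡ-+ q _ (M * k) ⟨
      q * (∑[ x ∈ S ] (∑[ y ∈ S ] agreement y x) + M * k)
        ≤⟨ *-monoʳ-≤ q (∑∈-∑∈-agreement≤ S-unique S-agree) ⟩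
      q * (M * (n + M * k))                          ≡⟨ rearrangeʳ q M n k ⟩
      q * (M * n) + M * (M * (q * k))                ≡⟨ cong (λ t → q * (M * n) + M * (M * t)) qk≡n ⟩
      q * (M * n) + M * (M * n)                      ∎
      where
      open ≤-Reasoning
      rearrangeˡ : ∀ q M k → M * (q * k) ≡ q * (M * k)
      rearrangeˡ = solve-∀
      rearrangeʳ : ∀ q M n k → q * (M * (n + M * k)) ≡ q * (M * n) + M * (M * (q * k))
      rearrangeʳ = solve-∀

  length≤n : length S ≤ n
  length≤n = m*m≤m*n⇒m≤n (*-cancelˡ-≤ p (+-cancelʳ-≤ (M * n + n * (M * M)) _ _ (begin
    p * (M * M) + (M * n + n * (M * M))       ≡⟨ rearrangeˡ p n M ⟩
    n * (M * M) + p * (M * M) + M * n         ≤⟨ +-monoˡ-≤ (M * n) lower ⟩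
    q * ∑[ j < n ] column² j + M * n          ≤⟨ upper ⟩
    q * (M * n) + M * (M * n)                 ≡⟨ rearrangeʳ p n M ⟩
    p * (M * n) + (M * n + n * (M * M))       ∎)))
    where
    open ≤-Reasoning
    rearrangeˡ : ∀ p n M → p * (M * M) + (M * n + n * (M * M)) ≡ n * (M * M) + p * (M * M) + M * n
    rearrangeˡ = solve-∀
    rearrangeʳ : ∀ p n M → suc p * (M * n) + M * (M * n) ≡ p * (M * n) + (M * n + n * (M * M))
    rearrangeʳ = solve-∀
    m*m≤m*n⇒m≤n : ∀ {m n} → m * m ≤ m * n → m ≤ n
    m*m≤m*n⇒m≤n {zero}  _ = z≤n
    m*m≤m*n⇒m≤n {suc m} mm≤mn = *-cancelˡ-≤ (suc m) mm≤mn

  private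
    q∑column²≤ : M ≡ n → q * ∑[ j < n ] column² j ≤ n * (M * M) + p * (M * M)
    q∑column²≤ M≡n = +-cancelʳ-≤ (M * n) _ _ (begin
      q * ∑[ j < n ] column² j + M * n       ≤⟨ upper ⟩
      q * (M * n) + M * (M * n)              ≡⟨ cong (λ t → q * (M * n) + M * (M * t)) M≡n ⟨
      q * (M * n) + M * (M * M)              ≡⟨ cong₂ (λ s t → q * (M * s) + t * (M * M)) (sym M≡n) M≡n ⟩
      q * (M * M) + n * (M * M)              ≡⟨ rearrange p n (M * M) ⟩
      n * (M * M) + p * (M * M) + M * M      ≡⟨ cong (λ t → n * (M * M) + p * (M * M) + M * t) M≡n ⟩
      n * (M * M) + p * (M * M) + M * n      ∎)
      where
      open ≤-Reasoning
      rearrange : ∀ p n x → suc p * x + n * x ≡ n * x + p * x + x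
      rearrange = solve-∀

    column²-tight : M ≡ n → ∀ j → M * M + δ i j * (p * (M * M)) ≡ q * column² j
    column²-tight M≡n = ∑-mono-≤-tight column²-lower (begin
      ∑[ j < n ] (q * column² j)                 ≡⟨ *-distribˡ-sum q column² ⟨
      q * ∑[ j < n ] column² j                   ≤⟨ q∑column²≤ M≡n ⟩
      n * (M * M) + p * (M * M)                  ≡⟨ ∑-column²-lower ⟨
      ∑[ j < n ] (M * M + δ i j * (p * (M * M))) ∎)
      where open ≤-Reasoning

    q·column²≡[∑count]² : M ≡ n → ∀ j → i ≢ j → q * column² j ≡ sum (count S j) * sum (count S j)
    q·column²≡[∑count]² M≡n j i≢j = begin
      q * column² j                      ≡⟨ column²-tight M≡n j ⟨
      M * M + δ i j * (p * (M * M))      ≡⟨ cong (λ d → M * M + d * (p * (M * M))) (δ-≢ i≢j) ⟩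
      M * M + 0                          ≡⟨ +-identityʳ (M * M) ⟩
      M * M                              ≡⟨ cong (λ s → s * s) (count-total S j) ⟨
      sum (count S j) * sum (count S j)  ∎
      where open ≡-Reasoning

  balanced : length S ≡ n → ∀ j → i ≢ j → ∀ b → count S j b ≡ k
  balanced M≡n j i≢j b = *-cancelˡ-≡ (count S j b) k q (begin
    q * count S j b   ≡⟨ cauchy-schwarz-tight (count S j) (≤-reflexive (q·column²≡[∑count]² M≡n j i≢j)) b ⟩
    sum (count S j)   ≡⟨ count-total S j ⟩
    M                 ≡⟨ M≡n ⟩
    n                 ≡⟨ qk≡n ⟨
    q * k             ∎)
    where open ≡-Reasoning

module Extension {p n k : ℕ} .{{_ : NonZero p}} (qk≡n : suc p * k ≡ n)
  (C : List (Word (suc p) n)) (C-unique : Unique C) (C-agree : AgreementAtMost k C)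
  (|C|+1≡qn : suc (length C) ≡ suc p * n) where

  private
    q : ℕ
    q = suc p

  subcode : Fin n → Fin q → List (Word q n)
  subcode i a = filter (λ x → lookup x i ≟ a) C

  subcode-fixed : ∀ i a {x} → x ∈ subcode i a → lookup x i ≡ a
  subcode-fixed i a x∈Cᵢₐ = proj₂ (∈-filter⁻ (λ x → lookup x i ≟ a) {xs = C} x∈Cᵢₐ)

  subcode-unique : ∀ i a → Unique (subcode i a)
  subcode-unique i a = filter⁺ (λ x → lookup x i ≟ a) C-unique

  subcode-agree : ∀ i a → AgreementAtMost k (subcode i a)
  subcode-agree i a x∈ y∈ = C-agree (⊆C x∈) (⊆C y∈)
    where
    ⊆C : ∀ {x} → x ∈ subcode i a → x ∈ C
    ⊆C x∈ = proj₁ (∈-filter⁻ (λ x → lookup x i ≟ a) {xs = C} x∈)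

  module PlotkinSubcode (i : Fin n) (a : Fin q) =
    Plotkin qk≡n (subcode-unique i a) (subcode-agree i a) i (subcode-fixed i a)

  length-subcode : ∀ i a → length (subcode i a) ≡ count C i a
  length-subcode i a = begin
    length (subcode i a)                   ≡⟨ ∑∈-1≡length (subcode i a) ⟨
    ∑[ x ∈ subcode i a ] 1                 ≡⟨ ∑∈-filter (λ x → lookup x i) a C (λ _ → 1) ⟩
    ∑[ x ∈ C ] (δ (lookup x i) a * 1)
      ≡⟨ sum-cong-≗ (λ l → *-identityʳ (δ (lookup (List.lookup C l) i) a)) ⟩
    count C i a                            ∎
    where open ≡-Reasoning

  private
    not-all-full : ∀ i → ¬ (∀ a → n ≤ count C i a)
    not-all-full i all-full = 1+n≰n (begin
      suc (length C)           ≡⟨ |C|+1≡qn ⟩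
      q * n                    ≡⟨ ∑-const q n ⟨
      ∑[ a < q ] n             ≤⟨ ∑-mono-≤ all-full ⟩
      ∑[ a < q ] count C i a   ≡⟨ count-total C i ⟩
      length C                 ∎)
      where open ≤-Reasoning

    missing-exists : ∀ i → ∃[ a ] count C i a < n
    missing-exists i =
      map₂ ≰⇒> (¬∀⟶∃¬ q (λ a → n ≤ count C i a) (λ a → n ≤? count C i a) (not-all-full i))

  missing : Fin n → Fin q
  missing i = proj₁ (missing-exists i)

  count+δ≡n : ∀ i a → count C i a + δ (missing i) a ≡ n
  count+δ≡n i = ∑-mono-≤-tight bound (≤-reflexive (begin
    ∑[ a < q ] n                                         ≡⟨ ∑-const q n ⟩
    q * n                                                ≡⟨ |C|+1≡qn ⟨
    suc (length C)                                       ≡⟨ +-comm 1 (length C) ⟩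
    length C + 1                                         ≡⟨ cong₂ _+_ (count-total C i) (∑-δ≡1 (missing i)) ⟨
    ∑[ a < q ] count C i a + ∑[ a < q ] δ (missing i) a  ≡⟨ ∑-distrib-+ (count C i) (δ (missing i)) ⟨
    ∑[ a < q ] (count C i a + δ (missing i) a)           ∎))
    where
    open ≡-Reasoning
    bound : ∀ a → count C i a + δ (missing i) a ≤ n
    bound a with missing i ≟ a
    ... | yes refl = subst (_≤ n) (+-comm 1 _) (proj₂ (missing-exists i))
    ... | no _     = subst (_≤ n) (sym (+-identityʳ _))
                       (subst (_≤ n) (length-subcode i a) (PlotkinSubcode.length≤n i a))

  subcode-balanced : ∀ i a → missing i ≢ a → ∀ j → i ≢ j → ∀ b → count (subcode i a) j b ≡ k
  subcode-balanced i a missing≢a = PlotkinSubcode.balanced i a (begin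
    length (subcode i a)         ≡⟨ length-subcode i a ⟩
    count C i a                  ≡⟨ +-identityʳ _ ⟨
    count C i a + 0              ≡⟨ cong (count C i a +_) (δ-≢ missing≢a) ⟨
    count C i a + δ (missing i) a ≡⟨ count+δ≡n i a ⟩
    n                            ∎)
    where open ≡-Reasoning

  deficient : Fin n → List (Word q n)
  deficient i = subcode i (missing i)

  suc-length-deficient : ∀ i → suc (length (deficient i)) ≡ n
  suc-length-deficient i = begin
    suc (length (deficient i))                ≡⟨ +-comm 1 _ ⟩
    length (deficient i) + 1
      ≡⟨ cong₂ _+_ (length-subcode i (missing i)) (sym (δ-refl (missing i))) ⟩
    count C i (missing i) + δ (missing i) (missing i) ≡⟨ count+δ≡n i (missing i) ⟩
    n                                         ∎
    where open ≡-Reasoning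

  u : Word q n
  u = tabulate missing

  count-u∷deficient : ∀ i j → i ≢ j → ∀ b → count (u ∷ deficient i) j b ≡ k
  count-u∷deficient i j i≢j b = +-cancelʳ-≡ (q * k) _ _ (begin
    δ (lookup u j) b + count (deficient i) j b + q * k   ≡⟨ +-assoc (δ (lookup u j) b) _ (q * k) ⟩
    δ (lookup u j) b + (count (deficient i) j b + q * k)
      ≡⟨ cong (δ (lookup u j) b +_) (∑-except (missing i) others-balanced) ⟨
    δ (lookup u j) b + (∑[ a < q ] count (subcode i a) j b + k)
      ≡⟨ cong (λ c → δ (lookup u j) b + (c + k)) (∑-∑∈-filter (λ x → lookup x i) C (λ y → δ (lookup y j) b)) ⟩
    δ (lookup u j) b + (count C j b + k)                  ≡⟨ rearrange (δ (lookup u j) b) (count C j b) k ⟩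
    count C j b + δ (lookup u j) b + k
      ≡⟨ cong (λ c → count C j b + δ c b + k) (lookup∘tabulate missing j) ⟩
    count C j b + δ (missing j) b + k                     ≡⟨ cong (_+ k) (count+δ≡n j b) ⟩
    n + k                                                 ≡⟨ cong (_+ k) qk≡n ⟨
    q * k + k                                             ≡⟨ +-comm (q * k) k ⟩
    k + q * k                                             ∎)
    where
    open ≡-Reasoning
    others-balanced : ∀ a → missing i ≢ a → count (subcode i a) j b ≡ k
    others-balanced a missing≢a = subcode-balanced i a missing≢a j i≢j b
    rearrange : ∀ x y z → x + (y + z) ≡ y + x + z
    rearrange = solve-∀

  u∷deficient-fixed : ∀ i {x} → x ∈ u ∷ deficient i → lookup x i ≡ missing i
  u∷deficient-fixed i (here refl) = lookup∘tabulate missing i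
  u∷deficient-fixed i (there x∈) = subcode-fixed i (missing i) x∈

  ∑∈-agreement-u∷deficient : ∀ i y → lookup y i ≡ missing i →
                             agreement u y + ∑[ z ∈ deficient i ] agreement z y + k ≡ n + n * k
  ∑∈-agreement-u∷deficient i = ∑∈-agreement-balanced i (suc-length-deficient i)
                                 (u∷deficient-fixed i) (count-u∷deficient i)

  k≤agreement-u : ∀ i {y} → y ∈ deficient i → k ≤ agreement y u
  k≤agreement-u i {y} y∈D =
    subst (k ≤_) (agreement-sym u y) (+-cancelʳ-≤ (n + length (deficient i) * k) _ _ (begin
    k + (n + length (deficient i) * k)                    ≡⟨ rearrange k n (length (deficient i) * k) ⟩
    n + (k + length (deficient i) * k)                    ≡⟨ cong (λ m → n + m * k) (suc-length-deficient i) ⟩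
    n + n * k
      ≡⟨ ∑∈-agreement-u∷deficient i y (subcode-fixed i (missing i) y∈D) ⟨
    agreement u y + ∑[ z ∈ deficient i ] agreement z y + k ≡⟨ +-assoc (agreement u y) _ k ⟩
    agreement u y + (∑[ z ∈ deficient i ] agreement z y + k)
      ≤⟨ +-monoʳ-≤ (agreement u y) (∑∈-agreement≤ (subcode-unique i _) (subcode-agree i _) y∈D) ⟩
    agreement u y + (n + length (deficient i) * k)        ∎))
    where
    open ≤-Reasoning
    rearrange : ∀ a b c → a + (b + c) ≡ b + (a + c)
    rearrange = solve-∀

  ∑∈-agreement-u : ∀ i → ∑[ y ∈ deficient i ] agreement y u ≡ length (deficient i) * k
  ∑∈-agreement-u i = +-cancelʳ-≡ k _ _ (+-cancelˡ-≡ n _ _ (begin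
    n + (∑[ y ∈ deficient i ] agreement y u + k)             ≡⟨ +-assoc n _ k ⟨
    n + ∑[ y ∈ deficient i ] agreement y u + k
      ≡⟨ cong (λ m → m + ∑[ y ∈ deficient i ] agreement y u + k) (agreement-self u) ⟨
    agreement u u + ∑[ y ∈ deficient i ] agreement y u + k
      ≡⟨ ∑∈-agreement-u∷deficient i u (lookup∘tabulate missing i) ⟩
    n + n * k
      ≡⟨ cong (λ m → n + m * k) (suc-length-deficient i) ⟨
    n + (k + length (deficient i) * k)                       ≡⟨ cong (n +_) (+-comm k _) ⟩
    n + (length (deficient i) * k + k)                       ∎))
    where open ≡-Reasoning

  agreement-u≤k : ∀ {y} → y ∈ C → agreement y u ≤ k
  agreement-u≤k {y} y∈C with any? (λ i → lookup y i ≟ missing i)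
  ... | yes (i , yᵢ≡uᵢ) = ≤-reflexive (sym (∑∈-mono-≤-tight (k≤agreement-u i)
        (≤-reflexive (trans (∑∈-agreement-u i) (sym (∑∈-const (deficient i) k))))
        (∈-filter⁺ (λ x → lookup x i ≟ missing i) y∈C yᵢ≡uᵢ)))
  ... | no no-agreement = begin
    agreement y u
      ≤⟨ ∑-mono-≤ (λ j → ≤-reflexive (δ-≢ (yⱼ≢uⱼ j))) ⟩
    ∑[ j < n ] 0  ≡⟨ sum-replicate-zero n ⟩
    0             ≤⟨ z≤n ⟩
    k             ∎
    where
    open ≤-Reasoning
    yⱼ≢uⱼ : ∀ j → lookup y j ≢ lookup u j
    yⱼ≢uⱼ j yⱼ≡uⱼ = no-agreement (j , trans yⱼ≡uⱼ (lookup∘tabulate missing j))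

  n≰k : ¬ n ≤ k
  n≰k n≤k = 0≢1+n (sym (begin
    suc (length C) ≡⟨ |C|+1≡qn ⟩
    q * n          ≡⟨ cong (q *_) n≡0 ⟩
    q * 0          ≡⟨ *-zeroʳ q ⟩
    0              ∎))
    where
    open ≡-Reasoning
    k≡0 : k ≡ 0
    k≡0 = m*n≡0⇒m≡0 k p (trans (*-comm k p) (n≤0⇒n≡0 (+-cancelˡ-≤ k _ 0
            (subst₂ _≤_ (sym qk≡n) (sym (+-identityʳ k)) n≤k))))
    n≡0 : n ≡ 0
    n≡0 = trans (sym qk≡n) (trans (cong (q *_) k≡0) (*-zeroʳ q))

  u∉C : u ∉ C
  u∉C u∈C = n≰k (subst (_≤ k) (agreement-self u) (agreement-u≤k u∈C))

  u∷C-IsCode : ∀ {d} → d + k ≡ n → IsCode d C → IsCode d (u ∷ C)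
  u∷C-IsCode d+k≡n C-code (here refl) (here refl)  u≢u = contradiction refl u≢u
  u∷C-IsCode d+k≡n C-code {y = y} (here refl) (there y∈C) _ =
    agreement≤⇒hamming≥ d+k≡n u y (subst (_≤ k) (agreement-sym y u) (agreement-u≤k y∈C))
  u∷C-IsCode d+k≡n C-code {x = x} (there x∈C) (here refl) _ =
    agreement≤⇒hamming≥ d+k≡n x u (agreement-u≤k x∈C)
  u∷C-IsCode d+k≡n C-code (there x∈C) (there y∈C) x≢y = C-code x∈C y∈C x≢y

proposition23 : (q n d : ℕ) → 2 ≤ q → q * d ≡ (q ∸ 1) * n →
    (C : List (Word q n)) → Unique C → IsCode d C →
    suc (length C) ≡ q * n →
    ∃[ u ] (u ∉ C × IsCode d (u ∷ C))
proposition23 (suc (suc r)) n d (s≤s (s≤s z≤n)) qd≡pn C C-unique C-code |C|+1≡qn =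
  u , u∉C , u∷C-IsCode d+k≡n C-code
  where
  q k : ℕ
  q = suc (suc r)
  k = n ∸ d
  d≤n : d ≤ n
  d≤n = *-cancelˡ-≤ q (subst (_≤ q * n) (sym qd≡pn) (m≤n+m (suc r * n) n))
  d+k≡n : d + k ≡ n
  d+k≡n = m+[n∸m]≡n d≤n
  qk≡n : q * k ≡ n
  qk≡n = begin
    q * (n ∸ d)         ≡⟨ *-distribˡ-∸ q n d ⟩
    q * n ∸ q * d       ≡⟨ cong (q * n ∸_) qd≡pn ⟩
    n + suc r * n ∸ suc r * n ≡⟨ m+n∸n≡m n (suc r * n) ⟩
    n                   ∎
    where open ≡-Reasoning
  open Extension qk≡n C C-unique (IsCode⇒AgreementAtMost d+k≡n C-code) |C|+1≡qn
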